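{- Every equivalence class of $\mathcal{G}_4$ modulo the eight relations defining $\mathcal{GR}_4$ contains at least one canonical tree.
   Context: $\mathcal{G}_4$ is the free (non-symmetric) set-operad on four binary generators $\prec,\succ,\circ,\odot$; its elements of arity $n$ are planar binary trees with $n$ leaves whose internal nodes are labelled by $\prec,\succ,\circ,\odot$. $\mathcal{GR}_4$ is the quotient of $\mathcal{G}_4$ by the operad congruence generated by the relations (written with $x,y,z$ the three inputs) $(x\succ y)\prec z=x\succ(y\prec z)$, $(x\circ y)\circ z=x\circ(y\circ z)$, $(x\succ y)\circ z=x\succ(y\circ z)$, $(x\prec y)\circ z=x\circ(y\succ z)$, $(x\circ y)\prec z=x\circ(y\prec z)$, $(x\odot y)\odot z=x\odot(y\odot z)$, $(x\prec y)\prec z=x\prec(y\odot z)$, $(x\odot y)\succ z=x\succ(y\succ z)$. A tree in $\mathcal{G}_4$ is canonical if it avoids all the patterns occurring on the right-hand sides of these relations, i.e. there is no internal node labelled $a$ whose right child is an internal node labelled $b$ with $(a,b)\in\{(\succ,\prec),(\circ,\circ),(\succ,\circ),(\circ,\succ),(\circ,\prec),(\odot,\odot),(\prec,\odot),(\succ,\succ)\}$. -}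

module Defs where

open import Data.Product using (Σ; _×_; _,_)
open import Relation.Nullary using (¬_)
open import Relation.Binary.Construct.Closure.Equivalence using (EqClosure)

data Op : Set where
  ≺ ≻ ∘ ⊙ : Op

-- The elements of arity n of G₄ are the trees with n leaves;
-- all relations preserve the number of leaves, so we work with all trees at once.
data Tree : Set where
  leaf : Tree
  node : Op → Tree → Tree → Tree

-- The eight relations, oriented  left-hand side ⟶ right-hand side,
-- instantiated with arbitrary trees x y z (operadic substitution into inputs).
data Rel : Tree → Tree → Set where
  r1 : ∀ x y z → Rel (node ≺ (node ≻ x y) z) (node ≻ x (node ≺ y z))
  r2 : ∀ x y z → Rel (node ∘ (node ∘ x y) z) (node ∘ x (node ∘ y z))
  r3 : ∀ x y z → Rel (node ∘ (node ≻ x y) z) (node ≻ x (node ∘ y z))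
  r4 : ∀ x y z → Rel (node ∘ (node ≺ x y) z) (node ∘ x (node ≻ y z))
  r5 : ∀ x y z → Rel (node ≺ (node ∘ x y) z) (node ∘ x (node ≺ y z))
  r6 : ∀ x y z → Rel (node ⊙ (node ⊙ x y) z) (node ⊙ x (node ⊙ y z))
  r7 : ∀ x y z → Rel (node ≺ (node ≺ x y) z) (node ≺ x (node ⊙ y z))
  r8 : ∀ x y z → Rel (node ≻ (node ⊙ x y) z) (node ≻ x (node ≻ y z))

data Step : Tree → Tree → Set where
  here  : ∀ {s t} → Rel s t → Step s t
  left  : ∀ {a s t} r → Step s t → Step (node a s r) (node a t r)
  right : ∀ {a s t} l → Step s t → Step (node a l s) (node a l t)

_≈GR_ : Tree → Tree → Set
_≈GR_ = EqClosure Step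

-- Forbidden patterns (right-hand sides): node labelled a whose right child
-- is an internal node labelled b.
data Forbidden : Op → Op → Set where
  f1 : Forbidden ≻ ≺
  f2 : Forbidden ∘ ∘
  f3 : Forbidden ≻ ∘
  f4 : Forbidden ∘ ≻
  f5 : Forbidden ∘ ≺
  f6 : Forbidden ⊙ ⊙
  f7 : Forbidden ≺ ⊙
  f8 : Forbidden ≻ ≻

data Canonical : Tree → Set where
  leaf   : Canonical leaf
  node-l : ∀ {a l} → Canonical l → Canonical (node a l leaf)
  node-n : ∀ {a b l rl rr} → ¬ Forbidden a b → Canonical l →
           Canonical (node b rl rr) → Canonical (node a l (node b rl rr))

-- Every forbidden pattern a x (b y z) is the right-hand side of one of the
-- relations, so it can be rotated back to the left-hand side a' (b' x y) z.
-- Canonical forms are built bottom-up: to make  node a L R  canonical with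
-- L and R already canonical, either the root is not a forbidden pattern, or
-- we rotate, canonicalise  node b' L y  and then  node a' L' z.  Both calls
-- are on proper subtrees y, z of R, so this recursion is structural and no
-- termination argument for the rewriting system is needed.
module Submission where

open import Defs
open import Data.Product using (Σ; _×_; _,_)
open import Relation.Nullary using (yes; no)
open import Relation.Binary.Definitions using (Decidable)
import Relation.Binary.Construct.Closure.Equivalence as EqClosure
open import Relation.Binary.Bundles using (Setoid)
import Relation.Binary.Reasoning.Setoid as SetoidReasoning

open Setoid (EqClosure.setoid Step) using (refl; sym)
open SetoidReasoning (EqClosure.setoid Step)

LeftRotation : Op → Op → Set
LeftRotation a b =
  Σ Op λ a′ → Σ Op λ b′ → ∀ x y z → Rel (node a′ (node b′ x y) z) (node a x (node b y z))

forbidden? : Decidable Forbidden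
forbidden? ≻ ≺ = yes f1
forbidden? ∘ ∘ = yes f2
forbidden? ≻ ∘ = yes f3
forbidden? ∘ ≻ = yes f4
forbidden? ∘ ≺ = yes f5
forbidden? ⊙ ⊙ = yes f6
forbidden? ≺ ⊙ = yes f7
forbidden? ≻ ≻ = yes f8
forbidden? ≺ ≺ = no λ ()
forbidden? ≺ ≻ = no λ ()
forbidden? ≺ ∘ = no λ ()
forbidden? ≻ ⊙ = no λ ()
forbidden? ∘ ⊙ = no λ ()
forbidden? ⊙ ≺ = no λ ()
forbidden? ⊙ ≻ = no λ ()
forbidden? ⊙ ∘ = no λ ()

forbidden⇒leftRotation : ∀ {a b} → Forbidden a b → LeftRotation a b
forbidden⇒leftRotation f1 = ≺ , ≻ , r1
forbidden⇒leftRotation f2 = ∘ , ∘ , r2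
forbidden⇒leftRotation f3 = ∘ , ≻ , r3
forbidden⇒leftRotation f4 = ∘ , ≺ , r4
forbidden⇒leftRotation f5 = ≺ , ∘ , r5
forbidden⇒leftRotation f6 = ⊙ , ⊙ , r6
forbidden⇒leftRotation f7 = ≺ , ≺ , r7
forbidden⇒leftRotation f8 = ≻ , ⊙ , r8

canonical-left : ∀ {a l r} → Canonical (node a l r) → Canonical l
canonical-left (node-l cl)     = cl
canonical-left (node-n _ cl _) = cl

canonical-right : ∀ {a l r} → Canonical (node a l r) → Canonical r
canonical-right (node-l _)      = leaf
canonical-right (node-n _ _ cr) = cr

node-congˡ : ∀ {a l l′} r → l ≈GR l′ → node a l r ≈GR node a l′ r
node-congˡ r = EqClosure.gmap (λ l → node _ l r) (left r)

node-congʳ : ∀ {a r r′} l → r ≈GR r′ → node a l r ≈GR node a l r′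
node-congʳ l = EqClosure.gmap (λ r → node _ l r) (right l)

CanonicalForm : Tree → Set
CanonicalForm t = Σ Tree λ u → (t ≈GR u) × Canonical u

canonicalForm-node : ∀ a {L R} → Canonical L → Canonical R → CanonicalForm (node a L R)
canonicalForm-node a {L} {leaf} cL _ = node a L leaf , refl , node-l cL
canonicalForm-node a {L} {node b y z} cL cR with forbidden? a b
... | no ¬f = node a L (node b y z) , refl , node-n ¬f cL cR
... | yes f with forbidden⇒leftRotation f
... | a′ , b′ , rotate
  with canonicalForm-node b′ cL (canonical-left cR)
... | L′ , L≈L′ , cL′
  with canonicalForm-node a′ cL′ (canonical-right cR)
... | u , ≈u , cu = u , node-a-L-R≈u , cu
  where
  node-a-L-R≈u : node a L (node b y z) ≈GR u
  node-a-L-R≈u = begin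
    node a L (node b y z)   ≈⟨ sym (EqClosure.return (here (rotate L y z))) ⟩
    node a′ (node b′ L y) z ≈⟨ node-congˡ z L≈L′ ⟩
    node a′ L′ z            ≈⟨ ≈u ⟩
    u                       ∎

mainTheorem3 : (t : Tree) → Σ Tree (λ u → (t ≈GR u) × Canonical u)
mainTheorem3 leaf = leaf , refl , leaf
mainTheorem3 (node a l r) with mainTheorem3 l | mainTheorem3 r
... | l′ , l≈l′ , cl′ | r′ , r≈r′ , cr′ with canonicalForm-node a cl′ cr′
... | u , ≈u , cu = u , t≈u , cu
  where
  t≈u : node a l r ≈GR u
  t≈u = begin
    node a l r   ≈⟨ node-congˡ r l≈l′ ⟩
    node a l′ r  ≈⟨ node-congʳ l′ r≈r′ ⟩
    node a l′ r′ ≈⟨ ≈u ⟩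
    u            ∎
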